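{- Let $m\in\mathbb{N}$, $a\in\mathrm{R}_m$ and $k\in\mathbb{N}$. If the congruence $x^k\equiv a\pmod m$ is solvable for $x\in\mathbb{Z}_m$, then \[ a^{\frac{\varphi(m)}{(k,\varphi(m))}}\bmod m\in\mathrm{E}_m. \]
   Context: $\mathbb{N}=\{1,2,\dots\}$, $\mathbb{Z}_m=\{1,\dots,m\}$, $x\bmod m$ denotes the element of $\mathbb{Z}_m$ congruent to $x$, $\varphi$ is Euler's totient function, $(u,v)$ is the gcd. $\mathrm{E}_m=\{e\in\mathbb{Z}_m: e^2\equiv e\pmod m\}$. For $a\in\mathbb{Z}$, $|a|_m$ is the smallest $n\in\mathbb{N}$ with $a^n\bmod m\in\mathrm{E}_m$. $a\in\mathbb{Z}_m$ is regular if $a^{|a|_m+1}\equiv a\pmod m$; $\mathrm{R}_m$ is the set of regular residues. -}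

module Defs where

open import Data.Nat using (ℕ; zero; suc; _+_; _*_; _^_; _≤_; _<_; NonZero; ≢-nonZero)
open import Data.Sum using (inj₁)
open import Data.Nat.DivMod using (_%_; _/_)
open import Data.Nat.GCD using (gcd; gcd[m,n]≢0)
open import Data.Nat.Properties using (m<n⇒n≢0)
open import Data.Nat.Properties using (_≟_)
open import Data.List using (List; length; filter; upTo; map)
open import Data.Product using (Σ; _×_; ∃)
open import Relation.Binary.PropositionalEquality using (_≡_)
open import Relation.Nullary using (¬_; yes; no)

Cong : ℕ → ℕ → (m : ℕ) → .{{NonZero m}} → Set
Cong x y m = x % m ≡ y % m

-- x mod m : the element of ℤ_m = {1,…,m} congruent to x.
modZ : ℕ → (m : ℕ) → .{{NonZero m}} → ℕ
modZ x m with x % m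
... | zero  = m
... | suc r = suc r

InZ : ℕ → ℕ → Set
InZ m x = (1 ≤ x) × (x ≤ m)

InE : (m : ℕ) → .{{NonZero m}} → ℕ → Set
InE m e = InZ m e × Cong (e * e) e m

IsIdx : (m : ℕ) → .{{NonZero m}} → ℕ → ℕ → Set
IsIdx m a n = (1 ≤ n) × InE m (modZ (a ^ n) m)
              × (∀ j → 1 ≤ j → j < n → ¬ InE m (modZ (a ^ j) m))

InR : (m : ℕ) → .{{NonZero m}} → ℕ → Set
InR m a = InZ m a × Σ ℕ (λ n → IsIdx m a n × Cong (a ^ (n + 1)) a m)

φ : ℕ → ℕ
φ m = length (filter (λ x → gcd x m ≟ 1) (map suc (upTo m)))

divGcd : (n k : ℕ) → .{{NonZero k}} → ℕ
divGcd n (suc k) = _/_ n (gcd (suc k) n) {{≢-nonZero (gcd[m,n]≢0 (suc k) n (inj₁ (λ ())))}}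

module Submission where

-- A regular residue a lies in the maximal subgroup of the multiplicative
-- monoid ℤ/m at the idempotent E = a^|a|: a·E ≡ a and a·a^(|a|-1) ≡ E.  With the
-- complementary idempotent F ≡ 1 - E, every element z of this subgroup lifts to the
-- unit z + F, and (z + F)^t ≡ z^t + F for t ≥ 1.  Euler's theorem for the unit z + F
-- therefore gives z^t ≡ E whenever φ(m) ∣ t and t ≥ 1.  If x^k ≡ a, then x·E is in
-- the subgroup and (x·E)^k ≡ a; since φ(m) ∣ k·d we get a^d ≡ (x·E)^(k·d) ≡ E (or
-- d = 0), so a^d is idempotent.

open import Data.Nat using (ℕ; zero; suc; _+_; _*_; _∸_; _^_; _<_; s≤s; z≤n; NonZero; ≢-nonZero; ≢-nonZero⁻¹)
open import Data.Nat.Properties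
  using (_≟_; suc-injective; +-identityʳ; +-assoc; +-comm; *-comm; *-assoc; *-identityˡ; *-identityʳ; *-zeroʳ;
         *-distribˡ-+; *-distribʳ-+;
         ^-*-assoc; ^-zeroˡ; m∸n+n≡m; ≤-refl; <⇒≤; n≢0⇒n>0; m≤n⇒m<n∨m≡n)
open import Data.Nat.DivMod using (_%_; _/_; %-distribˡ-+; %-distribˡ-*; m%n%n≡m%n; n%n≡0; m%n<n; m%n≤n; m<n⇒m%n≡m; [m+kn]%n≡m%n; *-/-assoc)
open import Data.Nat.Divisibility using (_∣_; divides; ∣-trans; m∣m*n; ∣1⇒≡1; %-presˡ-∣; ∣n∣m%n⇒∣m)
open import Data.Nat.GCD using (gcd; gcd[m,n]∣m; gcd[m,n]∣n; gcd[m,n]≢0; module Bézout)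
open import Data.Nat.Coprimality using (coprime-Bézout; gcd≡1⇒coprime)
open import Data.Nat.ListAction using (product)
open import Data.Nat.ListAction.Properties using (product-↭)
open import Data.Nat.Tactic.RingSolver using (solve-∀)
open import Data.List using (List; []; _∷_; _++_; map; filter; upTo; length)
open import Data.List.Properties using (length-map)
open import Data.List.Relation.Unary.All as All using ([]; _∷_)
open import Data.List.Relation.Unary.All.Properties as AllP using ()
open import Data.List.Relation.Unary.Any using (here; there)
open import Data.List.Relation.Unary.Unique.Propositional using (Unique)
open import Data.List.Relation.Unary.AllPairs using ([]; _∷_)
import Data.List.Relation.Unary.Unique.Propositional.Properties as UniqueP
open import Data.List.Membership.Propositional using (_∈_)
open import Data.List.Membership.Propositional.Properties
  using (∈-∃++; ∈-filter⁺; ∈-filter⁻; ∈-map⁺; ∈-map⁻; ∈-upTo⁺; ∈-upTo⁻)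
open import Data.List.Relation.Binary.Permutation.Propositional using (_↭_; prep; ↭-sym; ↭-trans; ↭-refl; ↭⇒↭ₛ)
open import Data.List.Relation.Binary.Permutation.Propositional.Properties using (shift; ↭-length; ∈-resp-↭)
import Data.List.Relation.Binary.Permutation.Setoid.Properties as PermSetoid
open import Data.Empty using (⊥-elim)
open import Data.Sum using (inj₁; inj₂)
open import Data.Product using (Σ; ∃-syntax; _×_; _,_; proj₁; proj₂)
open import Function using (_∘_)
open import Level using (0ℓ)
open import Relation.Binary.Bundles using (Setoid)
open import Relation.Binary.PropositionalEquality
open import Defs

unique-⊆-↭ : {A : Set} (xs : List A) {ys : List A} → Unique xs → Unique ys
           → (∀ {z} → z ∈ xs → z ∈ ys) → length xs ≡ length ys → xs ↭ ys
unique-⊆-↭ [] {[]} _ _ _ _ = ↭-refl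
unique-⊆-↭ (x ∷ xs) (x∉xs ∷ uxs) uys xs⊆ys len with ∈-∃++ (xs⊆ys (here refl))
... | ys₁ , ys₂ , refl =
  ↭-trans (prep x (unique-⊆-↭ xs uxs uys′ xs⊆ys′ len′)) (↭-sym moveX)
  where
  moveX : ys₁ ++ x ∷ ys₂ ↭ x ∷ ys₁ ++ ys₂
  moveX = shift x ys₁ ys₂
  uys′ : Unique (ys₁ ++ ys₂)
  uys′ with PermSetoid.Unique-resp-↭ (setoid _) (↭⇒↭ₛ moveX) uys
  ... | _ ∷ u = u
  xs⊆ys′ : ∀ {z} → z ∈ xs → z ∈ ys₁ ++ ys₂
  xs⊆ys′ z∈xs with ∈-resp-↭ moveX (xs⊆ys (there z∈xs))
  ... | here z≡x  = ⊥-elim (All.lookup x∉xs z∈xs (sym z≡x))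
  ... | there z∈ = z∈
  len′ : length xs ≡ length (ys₁ ++ ys₂)
  len′ = suc-injective (trans len (↭-length moveX))

unique-map : {A B : Set} (f : A → B) {xs : List A}
           → (∀ {a b} → a ∈ xs → b ∈ xs → f a ≡ f b → a ≡ b) → Unique xs → Unique (map f xs)
unique-map f {[]} _ [] = []
unique-map f {x ∷ xs} inj (x∉xs ∷ u) =
  AllP.map⁺ (All.tabulate (λ b∈xs fx≡fb → All.lookup x∉xs b∈xs (inj (here refl) (there b∈xs) fx≡fb)))
  ∷ unique-map f (λ a∈ b∈ → inj (there a∈) (there b∈)) u

-- The ring identity behind splitting products along the idempotents E and F.
expand-+F : ∀ z w F → (z + F) * (w + F) ≡ z * w + (z * F + (w * F + F * F))
expand-+F = solve-∀

module Modulo (m : ℕ) .{{_ : NonZero m}} where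

  infix 4 _≈_
  _≈_ : ℕ → ℕ → Set
  x ≈ y = Cong x y m

  ≈-setoid : Setoid 0ℓ 0ℓ
  ≈-setoid = record { Carrier = ℕ ; _≈_ = _≈_ ; isEquivalence = record { refl = refl ; sym = sym ; trans = trans } }

  open import Relation.Binary.Reasoning.Setoid ≈-setoid

  +-cong : ∀ {a b c d} → a ≈ b → c ≈ d → a + c ≈ b + d
  +-cong {a} {b} {c} {d} p q =
    trans (%-distribˡ-+ a c m) (trans (cong₂ (λ u v → (u + v) % m) p q) (sym (%-distribˡ-+ b d m)))

  *-cong : ∀ {a b c d} → a ≈ b → c ≈ d → a * c ≈ b * d
  *-cong {a} {b} {c} {d} p q =
    trans (%-distribˡ-* a c m) (trans (cong₂ (λ u v → (u * v) % m) p q) (sym (%-distribˡ-* b d m)))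

  +-congˡ : ∀ c {a b} → a ≈ b → c + a ≈ c + b
  +-congˡ c = +-cong {c} refl

  +-congʳ : ∀ c {a b} → a ≈ b → a + c ≈ b + c
  +-congʳ c p = +-cong p (refl {x = c % m})

  *-congˡ : ∀ c {a b} → a ≈ b → c * a ≈ c * b
  *-congˡ c = *-cong {c} refl

  *-congʳ : ∀ c {a b} → a ≈ b → a * c ≈ b * c
  *-congʳ c p = *-cong p (refl {x = c % m})

  ^-cong : ∀ {a b} → a ≈ b → ∀ n → a ^ n ≈ b ^ n
  ^-cong p zero    = refl
  ^-cong p (suc n) = *-cong p (^-cong p n)

  %-≈ : ∀ x → x % m ≈ x
  %-≈ x = m%n%n≡m%n x m

  m≈0 : m ≈ 0
  m≈0 = trans (n%n≡0 m) (sym (m<n⇒m%n≡m (n≢0⇒n>0 (≢-nonZero⁻¹ m))))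

  neg : ℕ → ℕ
  neg x = m ∸ x % m

  neg-inverse : ∀ x → neg x + x ≈ 0
  neg-inverse x = begin
    neg x + x       ≈⟨ +-congˡ (neg x) (%-≈ x) ⟨
    neg x + x % m   ≡⟨ m∸n+n≡m (m%n≤n x m) ⟩
    m               ≈⟨ m≈0 ⟩
    0               ∎

  +-cancelˡ : ∀ p {q r} → p + q ≈ p + r → q ≈ r
  +-cancelˡ p {q} {r} h = begin
    q                 ≈⟨ +-congʳ q (neg-inverse p) ⟨
    neg p + p + q     ≡⟨ +-assoc (neg p) p q ⟩
    neg p + (p + q)   ≈⟨ +-congˡ (neg p) h ⟩
    neg p + (p + r)   ≡⟨ +-assoc (neg p) p r ⟨
    neg p + p + r     ≈⟨ +-congʳ r (neg-inverse p) ⟩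
    r                 ∎

  +-cancelʳ : ∀ p {q r} → q + p ≈ r + p → q ≈ r
  +-cancelʳ p {q} {r} h = +-cancelˡ p (trans (cong (_% m) (+-comm p q)) (trans h (cong (_% m) (+-comm r p))))

  modZ-≈ : ∀ x → modZ x m ≈ x
  modZ-≈ x with x % m in eq
  ... | zero  = n%n≡0 m
  ... | suc r = m<n⇒m%n≡m (subst (_< m) eq (m%n<n x m))

  modZ-InZ : ∀ x → InZ m (modZ x m)
  modZ-InZ x with x % m in eq
  ... | zero  = n≢0⇒n>0 (≢-nonZero⁻¹ m) , ≤-refl
  ... | suc r = s≤s z≤n , <⇒≤ (subst (_< m) eq (m%n<n x m))

  modZ-cong : ∀ x y → x ≈ y → modZ x m ≡ modZ y m
  modZ-cong x y p with x % m | y % m | p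
  ... | r | .r | refl = refl

  modZ-fixes : ∀ {r} → InZ m r → modZ r m ≡ r
  modZ-fixes {suc t} (_ , r≤m) with m≤n⇒m<n∨m≡n r≤m
  ... | inj₁ r<m with suc t % m | m<n⇒m%n≡m r<m
  ...   | .(suc t) | refl = refl
  modZ-fixes {suc t} (_ , r≤m) | inj₂ r≡m with suc t % m | trans (cong (_% m) r≡m) (n%n≡0 m)
  ...   | .0 | refl = sym r≡m

  Unit : ℕ → Set
  Unit x = ∃[ w ] x * w ≈ 1

  unit-* : ∀ x y → Unit x → Unit y → Unit (x * y)
  unit-* x y (u , xu≈1) (v , yv≈1) = u * v , (begin
    x * y * (u * v)     ≡⟨ regroup x y u v ⟩
    (x * u) * (y * v)   ≈⟨ *-cong xu≈1 yv≈1 ⟩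
    1                   ∎)
    where
    regroup : ∀ x y u v → x * y * (u * v) ≡ (x * u) * (y * v)
    regroup = solve-∀

  unit-resp-≈ : ∀ x y → x ≈ y → Unit x → Unit y
  unit-resp-≈ x y x≈y (w , xw≈1) = w , trans (*-congʳ w (sym x≈y)) xw≈1

  unit-cancel : ∀ y {r s} → Unit y → y * r ≈ y * s → r ≈ s
  unit-cancel y {r} {s} (w , yw≈1) yr≈ys = begin
    r                ≡⟨ *-identityˡ r ⟨
    1 * r            ≈⟨ *-congʳ r yw≈1 ⟨
    y * w * r        ≡⟨ swap y w r ⟩
    w * (y * r)      ≈⟨ *-congˡ w yr≈ys ⟩
    w * (y * s)      ≡⟨ swap y w s ⟨
    y * w * s        ≈⟨ *-congʳ s yw≈1 ⟩
    1 * s            ≡⟨ *-identityˡ s ⟩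
    s                ∎
    where
    swap : ∀ y w r → y * w * r ≡ w * (y * r)
    swap = solve-∀

  unit⇒coprime : ∀ x → Unit x → gcd x m ≡ 1
  unit⇒coprime x (w , xw≈1) =
    ∣1⇒≡1 (∣n∣m%n⇒∣m g∣m (subst (gcd x m ∣_) xw≈1 (%-presˡ-∣ (∣-trans (gcd[m,n]∣m x m) (m∣m*n w)) g∣m)))
    where
    g∣m = gcd[m,n]∣n x m

  coprime⇒unit : ∀ x → gcd x m ≡ 1 → Unit x
  coprime⇒unit x g≡1 with coprime-Bézout (gcd≡1⇒coprime g≡1)
  ... | Bézout.+- a b 1+bm≡ax = a , (begin
    x * a          ≡⟨ trans (*-comm x a) (sym 1+bm≡ax) ⟩
    1 + b * m      ≈⟨ [m+kn]%n≡m%n 1 b m ⟩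
    1              ∎)
  ... | Bézout.-+ a b 1+ax≡bm = a * (m ∸ 1) , +-cancelʳ (m ∸ 1) (begin
    x * (a * (m ∸ 1)) + (m ∸ 1)   ≡⟨ factor x a (m ∸ 1) ⟩
    (1 + a * x) * (m ∸ 1)         ≡⟨ cong (_* (m ∸ 1)) 1+ax≡bm ⟩
    b * m * (m ∸ 1)               ≈⟨ *-congʳ (m ∸ 1) (*-congˡ b m≈0) ⟩
    b * 0 * (m ∸ 1)               ≡⟨ cong (_* (m ∸ 1)) (*-zeroʳ b) ⟩
    0                             ≈⟨ m≈0 ⟨
    m                             ≡⟨ m∸n+n≡m (n≢0⇒n>0 (≢-nonZero⁻¹ m)) ⟨
    m ∸ 1 + 1                     ≡⟨ +-comm (m ∸ 1) 1 ⟩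
    1 + (m ∸ 1)                   ∎)
    where
    factor : ∀ x a c → x * (a * c) + c ≡ (1 + a * x) * c
    factor = solve-∀

  unit-product : ∀ xs → (∀ {v} → v ∈ xs → Unit v) → Unit (product xs)
  unit-product []       _     = 1 , refl
  unit-product (x ∷ xs) units = unit-* x (product xs) (units (here refl)) (unit-product xs (units ∘ there))

  reduced : List ℕ
  reduced = filter (λ r → gcd r m ≟ 1) (map suc (upTo m))

  reduced-unique : Unique reduced
  reduced-unique = UniqueP.filter⁺ (λ r → gcd r m ≟ 1) (UniqueP.map⁺ suc-injective (UniqueP.upTo⁺ m))

  ∈-reduced⁺ : ∀ {r} → InZ m r → gcd r m ≡ 1 → r ∈ reduced
  ∈-reduced⁺ {suc t} (_ , r≤m) g≡1 = ∈-filter⁺ (λ r → gcd r m ≟ 1) (∈-map⁺ suc (∈-upTo⁺ r≤m)) g≡1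

  ∈-reduced⁻ : ∀ {r} → r ∈ reduced → InZ m r × gcd r m ≡ 1
  ∈-reduced⁻ r∈ with ∈-filter⁻ (λ r → gcd r m ≟ 1) {xs = map suc (upTo m)} r∈
  ... | r∈suc , g≡1 with ∈-map⁻ suc r∈suc
  ...   | t , t∈upTo , refl = (s≤s z≤n , ∈-upTo⁻ t∈upTo) , g≡1

  -- Euler's theorem: multiplication by a unit y permutes the reduced residues, so
  -- comparing products gives y^φ(m) · ∏ reduced ≡ ∏ reduced, and ∏ reduced is a unit.
  euler : ∀ y → Unit y → y ^ φ m ≈ 1
  euler y uy = unit-cancel P P-unit (begin
    P * y ^ φ m              ≡⟨ *-comm P (y ^ φ m) ⟩
    y ^ φ m * P              ≈⟨ product-map reduced ⟨
    product (map f reduced)  ≡⟨ product-↭ permutes ⟩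
    P                        ≡⟨ *-identityʳ P ⟨
    P * 1                    ∎)
    where
    P = product reduced

    P-unit : Unit P
    P-unit = unit-product reduced (λ {r} r∈ → coprime⇒unit r (proj₂ (∈-reduced⁻ r∈)))

    f : ℕ → ℕ
    f r = modZ (y * r) m

    f-maps : ∀ {r} → r ∈ reduced → f r ∈ reduced
    f-maps {r} r∈ = ∈-reduced⁺ (modZ-InZ (y * r))
      (unit⇒coprime (f r) (unit-resp-≈ (y * r) (f r) (sym (modZ-≈ (y * r))) (unit-* y r uy (coprime⇒unit r (proj₂ (∈-reduced⁻ r∈))))))

    f-injective : ∀ {r s} → r ∈ reduced → s ∈ reduced → f r ≡ f s → r ≡ s
    f-injective {r} {s} r∈ s∈ fr≡fs =
      trans (sym (modZ-fixes (proj₁ (∈-reduced⁻ r∈))))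
            (trans (modZ-cong r s (unit-cancel y uy yr≈ys)) (modZ-fixes (proj₁ (∈-reduced⁻ s∈))))
      where
      yr≈ys : y * r ≈ y * s
      yr≈ys = trans (sym (modZ-≈ (y * r))) (trans (cong (_% m) fr≡fs) (modZ-≈ (y * s)))

    permutes : map f reduced ↭ reduced
    permutes = unique-⊆-↭ (map f reduced) (unique-map f f-injective reduced-unique) reduced-unique
      (λ z∈ → let r , r∈ , z≡fr = ∈-map⁻ f z∈ in subst (_∈ reduced) (sym z≡fr) (f-maps r∈))
      (length-map f reduced)

    product-map : ∀ xs → product (map f xs) ≈ y ^ length xs * product xs
    product-map []       = refl
    product-map (r ∷ xs) = begin
      f r * product (map f xs)               ≈⟨ *-cong (modZ-≈ (y * r)) (product-map xs) ⟩
      y * r * (y ^ length xs * product xs)   ≡⟨ regroup y r (y ^ length xs) (product xs) ⟩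
      y * y ^ length xs * (r * product xs)   ∎
      where
      regroup : ∀ y r a p → y * r * (a * p) ≡ y * a * (r * p)
      regroup = solve-∀

  InE⇒idempotent : ∀ e → InE m (modZ e m) → e * e ≈ e
  InE⇒idempotent e (_ , idem) = trans (sym (*-cong (modZ-≈ e) (modZ-≈ e))) (trans idem (modZ-≈ e))

  idempotent⇒InE : ∀ e → e * e ≈ e → InE m (modZ e m)
  idempotent⇒InE e idem = modZ-InZ e , trans (*-cong (modZ-≈ e) (modZ-≈ e)) (trans idem (sym (modZ-≈ e)))

  -- z lies in the maximal subgroup of (ℤ/m, ·) at the idempotent E: it is fixed by E
  -- and has an inverse relative to E.
  InGroup : ℕ → ℕ → Set
  InGroup E z = z * E ≈ z × ∃[ z′ ] z * z′ ≈ E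

  -- A regular residue a lies in the subgroup at its idempotent power E = a^|a|,
  -- with inverse a^(|a|-1).
  regular⇒InGroup : ∀ a → InR m a → ∃[ E ] E * E ≈ E × InGroup E a
  regular⇒InGroup a (_ , suc n , (_ , aⁿ∈E , _) , regular) =
    a ^ suc n , InE⇒idempotent (a ^ suc n) aⁿ∈E , fixed , a ^ n , refl
    where
    fixed : a * a ^ suc n ≈ a
    fixed = trans (cong (λ e → a ^ e % m) (+-comm 1 (suc n))) regular

  module Idempotent (E : ℕ) (idem : E * E ≈ E) where

    F : ℕ
    F = neg E + 1

    E+F≈1 : E + F ≈ 1
    E+F≈1 = begin
      E + (neg E + 1)   ≡⟨ +-assoc E (neg E) 1 ⟨
      E + neg E + 1     ≡⟨ cong (_+ 1) (+-comm E (neg E)) ⟩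
      neg E + E + 1     ≈⟨ +-congʳ 1 (neg-inverse E) ⟩
      1                 ∎

    E*F≈0 : E * F ≈ 0
    E*F≈0 = +-cancelˡ (E * E) (begin
      E * E + E * F   ≡⟨ *-distribˡ-+ E E F ⟨
      E * (E + F)     ≈⟨ *-congˡ E E+F≈1 ⟩
      E * 1           ≡⟨ *-identityʳ E ⟩
      E               ≈⟨ idem ⟨
      E * E           ≡⟨ +-identityʳ (E * E) ⟨
      E * E + 0       ∎)

    F*F≈F : F * F ≈ F
    F*F≈F = +-cancelˡ (E * F) (begin
      E * F + F * F   ≡⟨ *-distribʳ-+ F E F ⟨
      (E + F) * F     ≈⟨ *-congʳ F E+F≈1 ⟩
      1 * F           ≡⟨ *-identityˡ F ⟩
      F               ≈⟨ +-congʳ F E*F≈0 ⟨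
      E * F + F       ∎)

    fixed⇒annihilated : ∀ z → z * E ≈ z → z * F ≈ 0
    fixed⇒annihilated z zE≈z = begin
      z * F         ≈⟨ *-congʳ F zE≈z ⟨
      z * E * F     ≡⟨ *-assoc z E F ⟩
      z * (E * F)   ≈⟨ *-congˡ z E*F≈0 ⟩
      z * 0         ≡⟨ *-zeroʳ z ⟩
      0             ∎

    -- Since z·F ≡ 0 and F is idempotent, positive powers of z + F split: (z + F)^(j+1) ≡ z^(j+1) + F.
    split-pow : ∀ z → z * F ≈ 0 → ∀ j → (z + F) ^ suc j ≈ z ^ suc j + F
    split-pow z zF≈0 zero = begin
      (z + F) * 1   ≡⟨ *-identityʳ (z + F) ⟩
      z + F         ≡⟨ cong (_+ F) (*-identityʳ z) ⟨
      z * 1 + F     ∎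
    split-pow z zF≈0 (suc j) = begin
      (z + F) * (z + F) ^ suc j          ≈⟨ *-congˡ (z + F) (split-pow z zF≈0 j) ⟩
      (z + F) * (Z + F)                  ≡⟨ expand-+F z Z F ⟩
      z * Z + (z * F + (Z * F + F * F))  ≈⟨ +-congˡ (z * Z) (+-cong zF≈0 (+-cong ZF≈0 F*F≈F)) ⟩
      z * Z + F                          ∎
      where
      Z = z ^ suc j
      ZF≈0 : Z * F ≈ 0
      ZF≈0 = begin
        z * z ^ j * F     ≡⟨ swap z (z ^ j) F ⟩
        z ^ j * (z * F)   ≈⟨ *-congˡ (z ^ j) zF≈0 ⟩
        z ^ j * 0         ≡⟨ *-zeroʳ (z ^ j) ⟩
        0                 ∎
        where
        swap : ∀ z y F → z * y * F ≡ y * (z * F)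
        swap = solve-∀

    -- Each element z of the subgroup at E lifts to the unit z + F, with inverse z′·E + F.
    group-unit : ∀ z → InGroup E z → Unit (z + F)
    group-unit z (zE≈z , z′ , zz′≈E) = w + F , (begin
      (z + F) * (w + F)                  ≡⟨ expand-+F z w F ⟩
      z * w + (z * F + (w * F + F * F))  ≈⟨ +-cong zw≈E (+-cong zF≈0 (+-cong wF≈0 F*F≈F)) ⟩
      E + F                              ≈⟨ E+F≈1 ⟩
      1                                  ∎)
      where
      w = z′ * E
      zF≈0 = fixed⇒annihilated z zE≈z
      wF≈0 = fixed⇒annihilated w (trans (cong (_% m) (*-assoc z′ E E)) (*-congˡ z′ idem))
      zw≈E : z * w ≈ E
      zw≈E = trans (cong (_% m) (sym (*-assoc z z′ E))) (trans (*-congʳ E zz′≈E) idem)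

    -- Euler's theorem for the lifted unit: the exponent of the subgroup at E divides φ(m).
    group-exponent : ∀ z → InGroup E z → ∀ t .{{_ : NonZero t}} → φ m ∣ t → z ^ t ≈ E
    group-exponent z z∈G (suc t) (divides q 1+t≡qφ) = +-cancelʳ F (begin
      z ^ suc t + F          ≈⟨ split-pow z (fixed⇒annihilated z (proj₁ z∈G)) t ⟨
      (z + F) ^ suc t        ≡⟨ cong ((z + F) ^_) (trans 1+t≡qφ (*-comm q (φ m))) ⟩
      (z + F) ^ (φ m * q)    ≡⟨ ^-*-assoc (z + F) (φ m) q ⟨
      ((z + F) ^ φ m) ^ q    ≈⟨ ^-cong (euler (z + F) (group-unit z z∈G)) q ⟩
      1 ^ q                  ≡⟨ ^-zeroˡ q ⟩
      1                      ≈⟨ E+F≈1 ⟨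
      E + F                  ∎)

    pow-times-E : ∀ x j → (x * E) ^ suc j ≈ x ^ suc j * E
    pow-times-E x zero = cong (_% m) (regroup x E)
      where
      regroup : ∀ x E → x * E * 1 ≡ x * 1 * E
      regroup = solve-∀
    pow-times-E x (suc j) = begin
      x * E * (x * E) ^ suc j            ≈⟨ *-congˡ (x * E) (pow-times-E x j) ⟩
      x * E * (x ^ suc j * E)            ≡⟨ regroup x (x ^ suc j) E ⟩
      x * x ^ suc j * (E * E)            ≈⟨ *-congˡ (x * x ^ suc j) idem ⟩
      x * x ^ suc j * E                  ∎
      where
      regroup : ∀ x y E → x * E * (y * E) ≡ x * y * (E * E)
      regroup = solve-∀

    root-in-group : ∀ a x k → InGroup E a → x ^ suc k ≈ a → InGroup E (x * E) × (x * E) ^ suc k ≈ a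
    root-in-group a x k (aE≈a , a′ , aa′≈E) xᵏ≈a = (fixed , x ^ k * a′ , inverse) , power
      where
      fixed : x * E * E ≈ x * E
      fixed = trans (cong (_% m) (*-assoc x E E)) (*-congˡ x idem)
      inverse : x * E * (x ^ k * a′) ≈ E
      inverse = begin
        x * E * (x ^ k * a′)     ≡⟨ regroup x E (x ^ k) a′ ⟩
        x * x ^ k * a′ * E       ≈⟨ *-congʳ E (*-congʳ a′ xᵏ≈a) ⟩
        a * a′ * E               ≈⟨ *-congʳ E aa′≈E ⟩
        E * E                    ≈⟨ idem ⟩
        E                        ∎
        where
        regroup : ∀ x E y b → x * E * (y * b) ≡ x * y * b * E
        regroup = solve-∀
      power : (x * E) ^ suc k ≈ a
      power = trans (pow-times-E x k) (trans (*-congʳ E xᵏ≈a) aE≈a)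

    -- If a is in the subgroup at E and a ≡ x^k, then a^d is idempotent whenever φ(m) ∣ k·d:
    -- for d ≥ 1, a^d ≡ (x·E)^(k·d) ≡ E.
    power-idempotent : ∀ a x k → InGroup E a → x ^ suc k ≈ a
                     → ∀ d → φ m ∣ suc k * d → a ^ d * a ^ d ≈ a ^ d
    power-idempotent a x k a∈G xᵏ≈a zero    _     = refl
    power-idempotent a x k a∈G xᵏ≈a (suc d) φ∣kd = begin
      a ^ suc d * a ^ suc d   ≈⟨ *-cong aᵈ≈E aᵈ≈E ⟩
      E * E                   ≈⟨ idem ⟩
      E                       ≈⟨ aᵈ≈E ⟨
      a ^ suc d               ∎
      where
      root = root-in-group a x k a∈G xᵏ≈a
      aᵈ≈E : a ^ suc d ≈ E
      aᵈ≈E = begin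
        a ^ suc d                     ≈⟨ ^-cong (proj₂ root) (suc d) ⟨
        ((x * E) ^ suc k) ^ suc d     ≡⟨ ^-*-assoc (x * E) (suc k) (suc d) ⟩
        (x * E) ^ (suc k * suc d)     ≈⟨ group-exponent (x * E) (proj₁ root) (suc k * suc d) φ∣kd ⟩
        E                             ∎

-- φ(m) divides k · φ(m)/(k, φ(m)), since k·n/g ≡ n·(k/g) for g = (k, n).
divGcd-multiple : ∀ n k .{{_ : NonZero k}} → n ∣ k * divGcd n k
divGcd-multiple n (suc k) = subst (n ∣_) reorder (m∣m*n (suc k / g))
  where
  g = gcd (suc k) n
  instance
    g≢0 : NonZero g
    g≢0 = ≢-nonZero (gcd[m,n]≢0 (suc k) n (inj₁ (λ ())))
  reorder : n * (suc k / g) ≡ suc k * (n / g)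
  reorder = trans (sym (*-/-assoc n (gcd[m,n]∣m (suc k) n)))
                  (trans (cong (_/ g) (*-comm n (suc k))) (*-/-assoc (suc k) (gcd[m,n]∣n (suc k) n)))

proposition3p1 : (m : ℕ) → .{{_ : NonZero m}} → (a k : ℕ) → .{{_ : NonZero k}}
    → InR m a
    → Σ ℕ (λ x → InZ m x × Cong (x ^ k) a m)
    → InE m (modZ (a ^ divGcd (φ m) k) m)
proposition3p1 m a (suc k) a∈R (x , _ , xᵏ≈a) with Modulo.regular⇒InGroup m a a∈R
... | E , idem , a∈G =
  idempotent⇒InE (a ^ d) (power-idempotent a x k a∈G xᵏ≈a d (divGcd-multiple (φ m) (suc k)))
  where
  open Modulo m
  open Idempotent E idem
  d = divGcd (φ m) (suc k)
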